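{- Let $\mathcal{M}=\langle Q,A,\delta\rangle$ be an MDP with $n=|Q|$ states, let $\alpha$ be the smallest positive probability in the transitions of $\mathcal{M}$, let $T\subseteq Q$, let $d_0$ be an initial distribution with smallest positive probability $\alpha_0$, and let $\epsilon_e=\alpha_0\cdot\alpha^{(n+1)\cdot 2^{n}}$. If $d_0$ is not limit-sure eventually synchronizing in $T$ (i.e. it is not the case that for every $\epsilon>0$ there exist a strategy $\sigma$ and $i\ge 0$ with $\mathcal{M}^{\sigma}_i(T)\ge 1-\epsilon$), then for all strategies $\sigma$ and all $i\ge 0$, $$\mathcal{M}^{\sigma}_i(T)\le 1-\epsilon_e.$$
   Context: An MDP is $\mathcal{M}=\langle Q,A,\delta\rangle$ with $Q$ finite set of states, $A$ finite set of actions, $\delta:Q\times A\to\mathcal{D}(Q)$ probabilistic transition function ($\mathcal{D}(Q)$ = probability distributions on $Q$). A (randomized) strategy is a function $\sigma:(QA)^*Q\to\mathcal{D}(A)$; with an initial distribution $d_0$ it induces a probability measure $\Pr^{\sigma}_{d_0}$ on infinite paths in the standard way. The distribution after $i$ steps is $\mathcal{M}^{\sigma}_i(q)=\Pr^{\sigma}_{d_0}(\text{the state at position } i \text{ is } q)$, with $\mathcal{M}^{\sigma}_0=d_0$; $d(T)=\sum_{q\in T}d(q)$. The smallest positive probability of $d_0$ is $\min\{d_0(q)\mid d_0(q)>0\}$.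
   Formalization: The transition probabilities of $\mathcal{M}$, the initial distribution $d_0$ and the strategies take rational values, and ε in the definition of limit-sure synchronization is also taken in ℚ. -}

module Defs where

open import Data.Nat as ℕ using (ℕ; zero; suc)
open import Data.Fin using (Fin; zero; suc; _≟_)
open import Data.Fin.Subset using (Subset)
open import Data.Vec using (lookup)
open import Data.Bool using (true; false; if_then_else_)
open import Data.List using (List; []; _∷_; [_]; _++_)
open import Data.Product using (_×_; _,_; ∃; ∃-syntax)
open import Data.Rational using (ℚ; 0ℚ; 1ℚ; _+_; _*_; _-_; _≤_; _<_)
open import Relation.Binary.PropositionalEquality using (_≡_)
open import Relation.Nullary using (¬_; does)

sumFin : {k : ℕ} → (Fin k → ℚ) → ℚ
sumFin {zero}  f = 0ℚ
sumFin {suc k} f = f zero + sumFin (λ i → f (suc i))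

_^ℚ_ : ℚ → ℕ → ℚ
x ^ℚ zero  = 1ℚ
x ^ℚ suc k = x * (x ^ℚ k)

IsDist : {k : ℕ} → (Fin k → ℚ) → Set
IsDist p = (∀ i → 0ℚ ≤ p i) × (sumFin p ≡ 1ℚ)

record MDP (n m : ℕ) : Set where
  field
    δ      : Fin n → Fin m → Fin n → ℚ
    δ-dist : ∀ q a → IsDist (δ q a)
open MDP public

-- A history (QA)*Q: a chronological list of (state, action) pairs and the current state
History : ℕ → ℕ → Set
History n m = List (Fin n × Fin m) × Fin n

record Strategy (n m : ℕ) : Set where
  field
    σ      : History n m → Fin m → ℚ
    σ-dist : ∀ h → IsDist (σ h)
open Strategy public

reachFrom : {n m : ℕ} → MDP n m → Strategy n m → ℕ →
            List (Fin n × Fin m) → Fin n → Fin n → ℚ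
reachFrom M S zero    h cur target = if does (cur ≟ target) then 1ℚ else 0ℚ
reachFrom M S (suc i) h cur target =
  sumFin (λ a → σ S (h , cur) a *
    sumFin (λ q′ → δ M cur a q′ * reachFrom M S i (h ++ [ (cur , a) ]) q′ target))

distAt : {n m : ℕ} → MDP n m → Strategy n m → (Fin n → ℚ) → ℕ → Fin n → ℚ
distAt M S d₀ i q = sumFin (λ q₀ → d₀ q₀ * reachFrom M S i [] q₀ q)

mass : {n : ℕ} → (Fin n → ℚ) → Subset n → ℚ
mass d T = sumFin (λ q → if lookup T q then d q else 0ℚ)

LimitSureEventually : {n m : ℕ} → MDP n m → Subset n → (Fin n → ℚ) → Set
LimitSureEventually M T d₀ =
  ∀ (ε : ℚ) → 0ℚ < ε → ∃[ S ] ∃[ i ] (1ℚ - ε ≤ mass (distAt M S d₀ i) T)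

IsMinPosTransition : {n m : ℕ} → MDP n m → ℚ → Set
IsMinPosTransition M α =
  (0ℚ < α) × (∃[ q ] ∃[ a ] ∃[ q′ ] (δ M q a q′ ≡ α)) ×
  (∀ q a q′ → 0ℚ < δ M q a q′ → α ≤ δ M q a q′)

IsMinPosProb : {n : ℕ} → (Fin n → ℚ) → ℚ → Set
IsMinPosProb d α₀ =
  (0ℚ < α₀) × (∃[ q ] (d q ≡ α₀)) × (∀ q → 0ℚ < d q → α₀ ≤ d q)

{-# OPTIONS --safe #-}
module Submission where

-- Let miss t q be the least probability, over all strategies, of not being in T after t steps
-- from q: value iteration computes it and the greedy strategies attain it.  If the mass in T at
-- step i exceeded 1 - α₀·α^N with N = (n+1)·2ⁿ, every state in the support of d₀ would have
-- miss i q < α^N.  Nonzero values of miss t are at least α^t, and the zero set of miss (t+1) is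
-- determined by that of miss t, so the zero sets are eventually periodic with prefix r and period
-- p, r + p ≤ 2ⁿ.  On phases × states let Y be the largest set from which, staying surely in Y,
-- the zero sets are reached with positive probability within p·n steps (a nested fixed point,
-- reached after p·n iterations).  Outside Y, miss ≥ α^(p·n + r) ≥ α^N, so the support lies in Y;
-- inside Y, every p·n further steps multiply the bound on miss by 1 - α^(p·n).  Hence miss
-- vanishes on the whole support along one sequence of times: d₀ is limit-sure eventually
-- synchronizing in T.

open import Defs
open import Data.Nat using (ℕ; suc) renaming (_*_ to _*ℕ_; _^_ to _^ℕ_)
open import Data.Fin.Subset using (Subset)
open import Data.Fin using (Fin)
open import Data.Rational using (ℚ; 1ℚ; _*_; _-_; _≤_)
open import Relation.Nullary using (¬_)

open import Function using (_∘_; _⇔_; mk⇔; Equivalence)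
open import Data.Nat using (zero; _∸_; z≤n; s≤s; _≤′_; ≤′-refl; ≤′-step) renaming (_+_ to _+ℕ_; _≤_ to _≤ℕ_; _<_ to _<ℕ_)
import Data.Nat.Properties as ℕ
open import Data.Fin using (zero; suc) renaming (_≟_ to _≟ᶠ_)
open import Data.Product as Product using (_×_; _,_; proj₁; proj₂; ∃-syntax)
open import Data.Sum as Sum using (_⊎_; inj₁; inj₂)
open import Data.Empty using (⊥-elim)
open import Data.Bool using (Bool; true; false; if_then_else_; _∨_; _∧_) renaming (T to IsTrue)
open import Data.Rational
  using (mkℚ; 0ℚ; _+_; -_; _<_; NonZero; nonNegative; positive; 1/_; toℚᵘ)
import Data.Rational.Unnormalised as ℚᵘ
open import Data.Rational.Unnormalised using (mkℚᵘ; *≡*)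
import Data.Rational.Unnormalised.Properties as ℚᵘ
import Data.Integer as ℤ
import Data.Integer.Properties as ℤ
open import Data.Rational.Properties
open import Data.Rational.Solver using (module +-*-Solver)
open import Algebra.Bundles using (Ring)
open import Algebra.Properties.CommutativeMonoid.Sum ℕ.+-0-commutativeMonoid using () renaming (sum to sumℕ)
open import Algebra.Properties.Ring +-*-ring using (-1*x≈-x; x[y-z]≈xy-xz)
open import Algebra.Properties.Semiring.Sum (Ring.semiring +-*-ring)
  using (sum; ∑-distrib-+; ∑-comm; *-distribˡ-sum; sum-replicate-zero)
open import Relation.Binary.PropositionalEquality hiding ([_])
open import Data.List using (List; []; [_]; _++_; length; allFin)
open import Data.List.Properties using (length-++)
open import Data.List.Relation.Unary.All as All using ()
open import Data.List.Membership.Propositional.Properties using (∈-allFin)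
open import Data.Vec using (lookup)
open import Relation.Binary.Bundles using (DecTotalOrder)
open import Data.List.Extrema (DecTotalOrder.totalOrder ≤-decTotalOrder) using (argmin; f[argmin]≤f[xs])
open import Relation.Nullary using (Dec; does; yes; no; contradiction; ¬?)
open import Data.Bool.Properties using (T-∨; T-∧)
open import Relation.Nullary.Decidable using (_×-dec_; _→-dec_; decidable-stable; isYes; toWitness; fromWitness; T?)
open import Data.Fin using (toℕ; funToFin; finToFun)
open import Data.Fin.Properties using (any?; all?; pigeonhole; toℕ≤pred[n]′; finToFun-funToFin; toℕ-fromℕ<; toℕ-injective)
open import Data.Nat.DivMod using (_%_; _/_; _mod_; m≡m%n+[m/n]*n; m%n<n; %-distribˡ-+; m%n%n≡m%n; [m+n]%n≡m%n; [m+kn]%n≡m%n)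
import Function.Properties.Equivalence as ⇔
open +-*-Solver

private
  variable
    k l : ℕ

p≤p+q : ∀ {p q} → 0ℚ ≤ q → p ≤ p + q
p≤p+q {p} {q} 0≤q = subst (_≤ p + q) (+-identityʳ p) (+-monoʳ-≤ p 0≤q)

q≤p+q : ∀ {p q} → 0ℚ ≤ p → q ≤ p + q
q≤p+q {p} {q} 0≤p = subst (q ≤_) (+-comm q p) (p≤p+q 0≤p)

*-nonneg : ∀ {p q} → 0ℚ ≤ p → 0ℚ ≤ q → 0ℚ ≤ p * q
*-nonneg {p} {q} 0≤p 0≤q = subst (_≤ p * q) (*-zeroʳ p) (*-monoˡ-≤-nonNeg p {{nonNegative 0≤p}} 0≤q)

*-monoˡ-≤-0≤ : ∀ {r p q} → 0ℚ ≤ r → p ≤ q → r * p ≤ r * q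
*-monoˡ-≤-0≤ {r} 0≤r = *-monoˡ-≤-nonNeg r {{nonNegative 0≤r}}

*-monoʳ-≤-0≤ : ∀ {r p q} → 0ℚ ≤ r → p ≤ q → p * r ≤ q * r
*-monoʳ-≤-0≤ {r} 0≤r = *-monoʳ-≤-nonNeg r {{nonNegative 0≤r}}

1-‿antimono-≤ : ∀ {p q} → p ≤ q → 1ℚ - q ≤ 1ℚ - p
1-‿antimono-≤ p≤q = +-monoʳ-≤ 1ℚ (neg-antimono-≤ p≤q)

1-‿cancel-< : ∀ {p q} → 1ℚ - p < 1ℚ - q → q < p
1-‿cancel-< {p} {q} 1-p<1-q = ≰⇒> (λ p≤q → <-irrefl refl (<-≤-trans 1-p<1-q (1-‿antimono-≤ p≤q)))

p≤1⇒0≤1-p : ∀ {p} → p ≤ 1ℚ → 0ℚ ≤ 1ℚ - p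
p≤1⇒0≤1-p {p} p≤1 = subst (_≤ 1ℚ - p) (+-inverseʳ p) (+-monoˡ-≤ (- p) p≤1)

sumFin≡sum : (f : Fin k → ℚ) → sumFin f ≡ sum f
sumFin≡sum {zero}  f = refl
sumFin≡sum {suc k} f = cong (f zero +_) (sumFin≡sum (f ∘ suc))

sumFin-cong : {f g : Fin k → ℚ} → f ≗ g → sumFin f ≡ sumFin g
sumFin-cong {zero}  f≗g = refl
sumFin-cong {suc k} f≗g = cong₂ _+_ (f≗g zero) (sumFin-cong (f≗g ∘ suc))

sumFin-mono : {f g : Fin k → ℚ} → (∀ i → f i ≤ g i) → sumFin f ≤ sumFin g
sumFin-mono {zero}  f≤g = ≤-refl
sumFin-mono {suc k} f≤g = +-mono-≤ (f≤g zero) (sumFin-mono (f≤g ∘ suc))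

sumFin-zero : ∀ k → sumFin {k} (λ _ → 0ℚ) ≡ 0ℚ
sumFin-zero k = trans (sumFin≡sum {k} (λ _ → 0ℚ)) (sum-replicate-zero k)

sumFin-+ : (f g : Fin k → ℚ) → sumFin (λ i → f i + g i) ≡ sumFin f + sumFin g
sumFin-+ f g = begin
  sumFin (λ i → f i + g i) ≡⟨ sumFin≡sum (λ i → f i + g i) ⟩
  sum (λ i → f i + g i)    ≡⟨ ∑-distrib-+ f g ⟩
  sum f + sum g            ≡⟨ cong₂ _+_ (sumFin≡sum f) (sumFin≡sum g) ⟨
  sumFin f + sumFin g      ∎
  where open ≡-Reasoning

sumFin-*ˡ : ∀ c (f : Fin k → ℚ) → sumFin (λ i → c * f i) ≡ c * sumFin f
sumFin-*ˡ c f = begin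
  sumFin (λ i → c * f i) ≡⟨ sumFin≡sum (λ i → c * f i) ⟩
  sum (λ i → c * f i)    ≡⟨ *-distribˡ-sum c f ⟨
  c * sum f              ≡⟨ cong (c *_) (sumFin≡sum f) ⟨
  c * sumFin f           ∎
  where open ≡-Reasoning

sumFin-- : (f g : Fin k → ℚ) → sumFin (λ i → f i - g i) ≡ sumFin f - sumFin g
sumFin-- f g = begin
  sumFin (λ i → f i - g i)            ≡⟨ sumFin-+ f (λ i → - g i) ⟩
  sumFin f + sumFin (λ i → - g i)     ≡⟨ cong (sumFin f +_) (sumFin-cong (λ i → -1*x≈-x (g i))) ⟨
  sumFin f + sumFin (λ i → - 1ℚ * g i) ≡⟨ cong (sumFin f +_) (trans (sumFin-*ˡ (- 1ℚ) g) (-1*x≈-x _)) ⟩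
  sumFin f - sumFin g                 ∎
  where open ≡-Reasoning

sumFin-comm : (f : Fin k → Fin l → ℚ) →
              sumFin (λ i → sumFin (f i)) ≡ sumFin (λ j → sumFin (λ i → f i j))
sumFin-comm f = begin
  sumFin (λ i → sumFin (f i))          ≡⟨ trans (sumFin-cong (sumFin≡sum ∘ f)) (sumFin≡sum (λ i → sum (f i))) ⟩
  sum (λ i → sum (f i))                ≡⟨ ∑-comm f ⟩
  sum (λ j → sum (λ i → f i j))        ≡⟨ trans (sumFin-cong (λ j → sumFin≡sum (λ i → f i j))) (sumFin≡sum (λ j → sum (λ i → f i j))) ⟨
  sumFin (λ j → sumFin (λ i → f i j))  ∎
  where open ≡-Reasoning

sumFin-nonneg : {f : Fin k → ℚ} → (∀ i → 0ℚ ≤ f i) → 0ℚ ≤ sumFin f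
sumFin-nonneg {k} {f} 0≤f = subst (_≤ sumFin f) (sumFin-zero k) (sumFin-mono 0≤f)

term≤sumFin : {f : Fin k → ℚ} → (∀ i → 0ℚ ≤ f i) → ∀ i → f i ≤ sumFin f
term≤sumFin 0≤f zero    = p≤p+q (sumFin-nonneg (0≤f ∘ suc))
term≤sumFin 0≤f (suc i) = ≤-trans (term≤sumFin (0≤f ∘ suc) i) (q≤p+q (0≤f zero))

dirac : Fin k → Fin k → ℚ
dirac i j = if does (i ≟ᶠ j) then 1ℚ else 0ℚ

sumFin-dirac : (i : Fin k) (f : Fin k → ℚ) → sumFin (λ j → dirac i j * f j) ≡ f i
sumFin-dirac {suc k} zero f = begin
  1ℚ * f zero + sumFin (λ j → 0ℚ * f (suc j)) ≡⟨ cong₂ _+_ (*-identityˡ (f zero)) (sumFin-cong (λ j → *-zeroˡ (f (suc j)))) ⟩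
  f zero + sumFin {k} (λ _ → 0ℚ)              ≡⟨ trans (cong (f zero +_) (sumFin-zero k)) (+-identityʳ _) ⟩
  f zero                                      ∎
  where open ≡-Reasoning
sumFin-dirac {suc k} (suc i) f = begin
  0ℚ * f zero + sumFin (λ j → dirac i j * f (suc j)) ≡⟨ cong₂ _+_ (*-zeroˡ (f zero)) (sumFin-dirac i (f ∘ suc)) ⟩
  0ℚ + f (suc i)                                    ≡⟨ +-identityˡ _ ⟩
  f (suc i)                                         ∎
  where open ≡-Reasoning

dirac-isDist : (i : Fin k) → IsDist (dirac i)
dirac-isDist i = 0≤dirac , trans (sumFin-cong (λ j → sym (*-identityʳ (dirac i j)))) (sumFin-dirac i (λ _ → 1ℚ))
  where
  0≤dirac : ∀ j → 0ℚ ≤ dirac i j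
  0≤dirac j with does (i ≟ᶠ j)
  ... | true  = nonNegative⁻¹ 1ℚ
  ... | false = ≤-refl

-- Opaque so that conversion checking never unfolds the search, which is very expensive.
opaque
  argminFin : (Fin (suc k) → ℚ) → Fin (suc k)
  argminFin {k} f = argmin f zero (allFin (suc k))

  argminFin-≤ : (f : Fin (suc k) → ℚ) → ∀ a → f (argminFin f) ≤ f a
  argminFin-≤ {k} f a = All.lookup (f[argmin]≤f[xs] {f = f} zero (allFin (suc k))) (∈-allFin a)

average-const : (w : Fin k → ℚ) → sumFin w ≡ 1ℚ → ∀ c → sumFin (λ i → w i * c) ≡ c
average-const w Σw≡1 c = begin
  sumFin (λ i → w i * c) ≡⟨ sumFin-cong (λ i → *-comm (w i) c) ⟩
  sumFin (λ i → c * w i) ≡⟨ sumFin-*ˡ c w ⟩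
  c * sumFin w           ≡⟨ cong (c *_) Σw≡1 ⟩
  c * 1ℚ                 ≡⟨ *-identityʳ c ⟩
  c                      ∎
  where open ≡-Reasoning

average-1- : (w : Fin k → ℚ) → sumFin w ≡ 1ℚ → (f : Fin k → ℚ) →
             sumFin (λ i → w i * (1ℚ - f i)) ≡ 1ℚ - sumFin (λ i → w i * f i)
average-1- w Σw≡1 f = begin
  sumFin (λ i → w i * (1ℚ - f i))                         ≡⟨ sumFin-cong (λ i → x[y-z]≈xy-xz (w i) 1ℚ (f i)) ⟩
  sumFin (λ i → w i * 1ℚ - w i * f i)                     ≡⟨ sumFin-- (λ i → w i * 1ℚ) (λ i → w i * f i) ⟩
  sumFin (λ i → w i * 1ℚ) - sumFin (λ i → w i * f i)      ≡⟨ cong (_- sumFin (λ i → w i * f i)) (average-const w Σw≡1 1ℚ) ⟩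
  1ℚ - sumFin (λ i → w i * f i)                           ∎
  where open ≡-Reasoning

weighted-mono : {w f g : Fin k → ℚ} → (∀ i → 0ℚ ≤ w i) → (∀ i → 0ℚ < w i → f i ≤ g i) →
                sumFin (λ i → w i * f i) ≤ sumFin (λ i → w i * g i)
weighted-mono {w = w} {f} {g} 0≤w f≤g = sumFin-mono term-mono
  where
  term-mono : ∀ i → w i * f i ≤ w i * g i
  term-mono i with 0ℚ <? w i
  ... | yes 0<wᵢ = *-monoˡ-≤-0≤ (0≤w i) (f≤g i 0<wᵢ)
  ... | no  0≮wᵢ rewrite ≤-antisym (≮⇒≥ 0≮wᵢ) (0≤w i) =
    ≤-reflexive (trans (*-zeroˡ (f i)) (sym (*-zeroˡ (g i))))

sumFin-interchange : (c : Fin k → ℚ) (w : Fin l → ℚ) (g : Fin l → Fin k → ℚ) →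
                     sumFin (λ t → c t * sumFin (λ a → w a * g a t)) ≡
                     sumFin (λ a → w a * sumFin (λ t → c t * g a t))
sumFin-interchange c w g = begin
  sumFin (λ t → c t * sumFin (λ a → w a * g a t))   ≡⟨ sumFin-cong (λ t → sumFin-*ˡ (c t) (λ a → w a * g a t)) ⟨
  sumFin (λ t → sumFin (λ a → c t * (w a * g a t))) ≡⟨ sumFin-comm (λ t a → c t * (w a * g a t)) ⟩
  sumFin (λ a → sumFin (λ t → c t * (w a * g a t))) ≡⟨ sumFin-cong (λ a → sumFin-cong (λ t → x*[y*z]≡y*[x*z] (c t) (w a) (g a t))) ⟩
  sumFin (λ a → sumFin (λ t → w a * (c t * g a t))) ≡⟨ sumFin-cong (λ a → sumFin-*ˡ (w a) (λ t → c t * g a t)) ⟩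
  sumFin (λ a → w a * sumFin (λ t → c t * g a t))   ∎
  where
  open ≡-Reasoning
  x*[y*z]≡y*[x*z] : ∀ x y z → x * (y * z) ≡ y * (x * z)
  x*[y*z]≡y*[x*z] = solve 3 (λ x y z → x :* (y :* z) := y :* (x :* z)) refl

-- Powers and geometric decay

^ℚ-nonneg : ∀ {x} k → 0ℚ ≤ x → 0ℚ ≤ x ^ℚ k
^ℚ-nonneg zero    0≤x = nonNegative⁻¹ 1ℚ
^ℚ-nonneg (suc k) 0≤x = *-nonneg 0≤x (^ℚ-nonneg k 0≤x)

^ℚ-pos : ∀ {x} k → 0ℚ < x → 0ℚ < x ^ℚ k
^ℚ-pos zero    0<x = positive⁻¹ 1ℚ
^ℚ-pos {x} (suc k) 0<x =
  subst (_< x * x ^ℚ k) (*-zeroʳ x) (*-monoʳ-<-pos x {{positive 0<x}} (^ℚ-pos k 0<x))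

^ℚ≤1 : ∀ {x} k → 0ℚ ≤ x → x ≤ 1ℚ → x ^ℚ k ≤ 1ℚ
^ℚ≤1 zero    0≤x x≤1 = ≤-refl
^ℚ≤1 {x} (suc k) 0≤x x≤1 =
  ≤-trans (*-monoˡ-≤-0≤ 0≤x (^ℚ≤1 k 0≤x x≤1)) (subst (_≤ 1ℚ) (sym (*-identityʳ x)) x≤1)

^ℚ-suc≤ : ∀ {x} k → 0ℚ ≤ x → x ≤ 1ℚ → x ^ℚ suc k ≤ x ^ℚ k
^ℚ-suc≤ {x} k 0≤x x≤1 =
  subst (x ^ℚ suc k ≤_) (*-identityˡ (x ^ℚ k)) (*-monoʳ-≤-0≤ (^ℚ-nonneg k 0≤x) x≤1)

^ℚ-antitone : ∀ {x k l} → 0ℚ ≤ x → x ≤ 1ℚ → k ≤ℕ l → x ^ℚ l ≤ x ^ℚ k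
^ℚ-antitone {x} 0≤x x≤1 k≤l = go (ℕ.≤⇒≤′ k≤l)
  where
  go : ∀ {k l} → k ≤′ l → x ^ℚ l ≤ x ^ℚ k
  go ≤′-refl                = ≤-refl
  go (≤′-step {l} k≤′l) = ≤-trans (^ℚ-suc≤ l 0≤x x≤1) (go k≤′l)

fromℕ : ℕ → ℚ
fromℕ zero    = 0ℚ
fromℕ (suc k) = 1ℚ + fromℕ k

fromℕ-nonneg : ∀ k → 0ℚ ≤ fromℕ k
fromℕ-nonneg zero    = ≤-refl
fromℕ-nonneg (suc k) = ≤-trans (fromℕ-nonneg k) (q≤p+q (nonNegative⁻¹ 1ℚ))

bernoulli : ∀ {x} k → 0ℚ ≤ x → x ≤ 1ℚ → (1ℚ - x) ^ℚ k * (1ℚ + fromℕ k * x) ≤ 1ℚ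
bernoulli {x} zero    0≤x x≤1 =
  ≤-reflexive (solve 1 (λ x → con 1ℚ :* (con 1ℚ :+ con 0ℚ :* x) := con 1ℚ) refl x)
bernoulli {x} (suc k) 0≤x x≤1 = begin
  (1ℚ - x) * P * (1ℚ + (1ℚ + K) * x)      ≡⟨ expand ⟩
  P * (1ℚ + K * x) - P * (x * x) * (1ℚ + K) ≤⟨ +-monoʳ-≤ (P * (1ℚ + K * x)) (neg-antimono-≤ loss-nonneg) ⟩
  P * (1ℚ + K * x) - 0ℚ                     ≡⟨ +-identityʳ (P * (1ℚ + K * x)) ⟩
  P * (1ℚ + K * x)                          ≤⟨ bernoulli k 0≤x x≤1 ⟩
  1ℚ                                        ∎
  where
  open ≤-Reasoning
  P K : ℚ
  P = (1ℚ - x) ^ℚ k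
  K = fromℕ k
  expand : (1ℚ - x) * P * (1ℚ + (1ℚ + K) * x) ≡ P * (1ℚ + K * x) - P * (x * x) * (1ℚ + K)
  expand = solve 3 (λ x P K → (con 1ℚ :- x) :* P :* (con 1ℚ :+ (con 1ℚ :+ K) :* x)
                            := P :* (con 1ℚ :+ K :* x) :- P :* (x :* x) :* (con 1ℚ :+ K)) refl x P K
  loss-nonneg : 0ℚ ≤ P * (x * x) * (1ℚ + K)
  loss-nonneg = *-nonneg (*-nonneg (^ℚ-nonneg k (p≤1⇒0≤1-p x≤1)) (*-nonneg 0≤x 0≤x))
                         (fromℕ-nonneg (suc k))

archimedean : ∀ q → ∃[ k ] q ≤ fromℕ k
archimedean q@(mkℚ n d _) =
  ℤ.∣ n ∣ , toℚᵘ-cancel-≤ (ℚᵘ.≤-respʳ-≃ (ℚᵘ.≃-sym (toℚᵘ-fromℕ ℤ.∣ n ∣)) (ℚᵘ.*≤* (n≤∣n∣*d n)))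
  where
  toℚᵘ-fromℕ : ∀ k → toℚᵘ (fromℕ k) ℚᵘ.≃ mkℚᵘ (ℤ.+ k) 0
  toℚᵘ-fromℕ zero    = *≡* refl
  toℚᵘ-fromℕ (suc k) = ℚᵘ.≃-trans (toℚᵘ-homo-+ 1ℚ (fromℕ k))
    (ℚᵘ.≃-trans (ℚᵘ.+-congʳ (toℚᵘ 1ℚ) (toℚᵘ-fromℕ k))
                (*≡* (cong (λ j → (ℤ.+ 1 ℤ.+ j) ℤ.* ℤ.+ 1) (ℤ.*-identityʳ (ℤ.+ k)))))
  n≤∣n∣*d : ∀ n → n ℤ.* ℤ.+ 1 ℤ.≤ ℤ.+ ℤ.∣ n ∣ ℤ.* ℤ.+ suc d
  n≤∣n∣*d (ℤ.+ a)    = ℤ.*-monoˡ-≤-nonNeg (ℤ.+ a) (ℤ.+≤+ (ℕ.m≤m+n 1 d))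
  n≤∣n∣*d ℤ.-[1+ a ] = ℤ.-≤+

geometric-decay : ∀ {x ε} → 0ℚ < x → x ≤ 1ℚ → 0ℚ < ε → ∃[ m ] (1ℚ - x) ^ℚ m ≤ ε
geometric-decay {x} {ε} 0<x x≤1 0<ε = m , P≤ε
  where
  instance
    εx-nonZero : NonZero (ε * x)
    εx-nonZero = pos⇒nonZero (ε * x) {{pos*pos⇒pos ε {{positive 0<ε}} x {{positive 0<x}}}}
  m : ℕ
  m = proj₁ (archimedean (1/ (ε * x)))
  M P : ℚ
  M = fromℕ m
  P = (1ℚ - x) ^ℚ m
  1≤ε[Mx] : 1ℚ ≤ ε * (M * x)
  1≤ε[Mx] = begin
    1ℚ                   ≡⟨ *-inverseʳ (ε * x) ⟨
    ε * x * 1/ (ε * x)   ≤⟨ *-monoˡ-≤-0≤ (*-nonneg (<⇒≤ 0<ε) (<⇒≤ 0<x)) (proj₂ (archimedean (1/ (ε * x)))) ⟩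
    ε * x * M            ≡⟨ solve 3 (λ ε x M → ε :* x :* M := ε :* (M :* x)) refl ε x M ⟩
    ε * (M * x)          ∎
    where open ≤-Reasoning
  0<Mx : 0ℚ < M * x
  0<Mx = *-cancelˡ-<-nonNeg ε {{nonNegative (<⇒≤ 0<ε)}}
           (subst (_< ε * (M * x)) (sym (*-zeroʳ ε)) (<-≤-trans (positive⁻¹ 1ℚ) 1≤ε[Mx]))
  P[Mx]≤ε[Mx] : P * (M * x) ≤ ε * (M * x)
  P[Mx]≤ε[Mx] = begin
    P * (M * x)          ≤⟨ q≤p+q (^ℚ-nonneg m (p≤1⇒0≤1-p x≤1)) ⟩
    P + P * (M * x)      ≡⟨ solve 3 (λ P M x → P :+ P :* (M :* x) := P :* (con 1ℚ :+ M :* x)) refl P M x ⟩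
    P * (1ℚ + M * x)     ≤⟨ bernoulli m (<⇒≤ 0<x) x≤1 ⟩
    1ℚ                   ≤⟨ 1≤ε[Mx] ⟩
    ε * (M * x)          ∎
    where open ≤-Reasoning
  P≤ε : P ≤ ε
  P≤ε = *-cancelʳ-≤-pos (M * x) {{positive 0<Mx}} P[Mx]≤ε[Mx]

-- Stabilisation of monotone chains of finite sets

m+[1+n]≤1+o⇒m+n≤o : ∀ {m n o} → m +ℕ suc n ≤ℕ suc o → m +ℕ n ≤ℕ o
m+[1+n]≤1+o⇒m+n≤o {m} {n} le = ℕ.≤-pred (ℕ.≤-trans (ℕ.≤-reflexive (sym (ℕ.+-suc m n))) le)

stalls-ascending : (c : ℕ → ℕ) → ∀ b → b ≤ℕ c b ⊎ ∃[ d ] (d <ℕ b × c (suc d) ≤ℕ c d)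
stalls-ascending c zero = inj₁ z≤n
stalls-ascending c (suc b) with stalls-ascending c b | c (suc b) ℕ.≤? c b
... | inj₂ (d , d<b , stall) | _         = inj₂ (d , ℕ.m≤n⇒m≤1+n d<b , stall)
... | inj₁ _                 | yes stall = inj₂ (b , ℕ.≤-refl , stall)
... | inj₁ b≤c               | no ¬stall = inj₁ (ℕ.≤-trans (s≤s b≤c) (ℕ.≰⇒> ¬stall))

stalls-descending : (c : ℕ → ℕ) → ∀ b → b +ℕ c b ≤ℕ c 0 ⊎ ∃[ d ] (d <ℕ b × c d ≤ℕ c (suc d))
stalls-descending c zero = inj₁ ℕ.≤-refl
stalls-descending c (suc b) with stalls-descending c b | c b ℕ.≤? c (suc b)
... | inj₂ (d , d<b , stall) | _         = inj₂ (d , ℕ.m≤n⇒m≤1+n d<b , stall)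
... | inj₁ _                 | yes stall = inj₂ (b , ℕ.≤-refl , stall)
... | inj₁ b+c≤c₀            | no ¬stall =
  inj₁ (ℕ.≤-trans (ℕ.≤-reflexive (sym (ℕ.+-suc b (c (suc b))))) (ℕ.≤-trans (ℕ.+-monoʳ-≤ b (ℕ.≰⇒> ¬stall)) b+c≤c₀))

bounded⇒stalls-ascending : (c : ℕ → ℕ) (K : ℕ) → (∀ d → c d ≤ℕ K) → ∃[ d ] (d ≤ℕ K × c (suc d) ≤ℕ c d)
bounded⇒stalls-ascending c K c≤K with stalls-ascending c (suc K)
... | inj₁ K<c             = contradiction (c≤K (suc K)) (ℕ.<⇒≱ K<c)
... | inj₂ (d , d≤K , stall) = d , ℕ.≤-pred d≤K , stall

bounded⇒stalls-descending : (c : ℕ → ℕ) (K : ℕ) → c 0 ≤ℕ K → ∃[ d ] (d ≤ℕ K × c d ≤ℕ c (suc d))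
bounded⇒stalls-descending c K c₀≤K with stalls-descending c (suc K)
... | inj₁ K<c₀             = contradiction (ℕ.≤-trans (ℕ.m≤m+n (suc K) _) K<c₀) (ℕ.<⇒≱ (s≤s c₀≤K))
... | inj₂ (d , d≤K , stall) = d , ℕ.≤-pred d≤K , stall

bit : Bool → ℕ
bit b = if b then 1 else 0

bit-mono : ∀ {b c} → (IsTrue b → IsTrue c) → bit b ≤ℕ bit c
bit-mono {false}         _   = z≤n
bit-mono {true}  {true}  _   = ℕ.≤-refl
bit-mono {true}  {false} b⇒c = ⊥-elim (b⇒c _)

bit-reflect : ∀ {b c} → bit c ≤ℕ bit b → IsTrue c → IsTrue b
bit-reflect {true}          _ _ = _
bit-reflect {false} {true}  () _

bit≤1 : ∀ b → bit b ≤ℕ 1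
bit≤1 true  = ℕ.≤-refl
bit≤1 false = z≤n

sumℕ-mono : {f g : Fin k → ℕ} → (∀ i → f i ≤ℕ g i) → sumℕ f ≤ℕ sumℕ g
sumℕ-mono {zero}  f≤g = z≤n
sumℕ-mono {suc k} f≤g = ℕ.+-mono-≤ (f≤g zero) (sumℕ-mono (f≤g ∘ suc))

sumℕ-reflect : {f g : Fin k → ℕ} → (∀ i → f i ≤ℕ g i) → sumℕ g ≤ℕ sumℕ f → ∀ i → g i ≤ℕ f i
sumℕ-reflect {suc k} {f} {g} f≤g Σg≤Σf zero = ℕ.+-cancelʳ-≤ (sumℕ (f ∘ suc)) (g zero) (f zero)
  (ℕ.≤-trans (ℕ.+-monoʳ-≤ (g zero) (sumℕ-mono (f≤g ∘ suc))) Σg≤Σf)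
sumℕ-reflect {suc k} {f} {g} f≤g Σg≤Σf (suc i) = sumℕ-reflect (f≤g ∘ suc)
  (ℕ.+-cancelˡ-≤ (f zero) _ _ (ℕ.≤-trans (ℕ.+-monoˡ-≤ (sumℕ (g ∘ suc)) (f≤g zero)) Σg≤Σf)) i

sumℕ≤ : ∀ {f : Fin k → ℕ} {c} → (∀ i → f i ≤ℕ c) → sumℕ f ≤ℕ k *ℕ c
sumℕ≤ {zero}  f≤c = z≤n
sumℕ≤ {suc k} f≤c = ℕ.+-mono-≤ (f≤c zero) (sumℕ≤ (f≤c ∘ suc))

BoolMatrix : ℕ → ℕ → Set
BoolMatrix k l = Fin k → Fin l → Bool

_⊆_ : BoolMatrix k l → BoolMatrix k l → Set
X ⊆ Y = ∀ i j → IsTrue (X i j) → IsTrue (Y i j)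

⊆-refl : {X : BoolMatrix k l} → X ⊆ X
⊆-refl i j x = x

count : BoolMatrix k l → ℕ
count X = sumℕ (λ i → sumℕ (λ j → bit (X i j)))

count-reflect : {X Y : BoolMatrix k l} → X ⊆ Y → count Y ≤ℕ count X → Y ⊆ X
count-reflect X⊆Y #Y≤#X i j = bit-reflect (sumℕ-reflect (λ j → bit-mono (X⊆Y i j))
  (sumℕ-reflect (λ i → sumℕ-mono (λ j → bit-mono (X⊆Y i j))) #Y≤#X i) j)

count≤ : (X : BoolMatrix k l) → count X ≤ℕ k *ℕ l
count≤ {l = l} X = sumℕ≤ (λ i → ℕ.≤-trans (sumℕ≤ (λ j → bit≤1 (X i j))) (ℕ.≤-reflexive (ℕ.*-identityʳ l)))

ascending-stabilises : (X : ℕ → BoolMatrix k l) → (∀ d → X d ⊆ X (suc d)) →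
                       (∀ d → X (suc d) ⊆ X d → X (suc (suc d)) ⊆ X (suc d)) →
                       X (suc (k *ℕ l)) ⊆ X (k *ℕ l)
ascending-stabilises {k} {l} X ascending propagates =
  stable (bounded⇒stalls-ascending (count ∘ X) (k *ℕ l) (count≤ ∘ X))
  where
  stable : ∃[ d ] (d ≤ℕ k *ℕ l × count (X (suc d)) ≤ℕ count (X d)) → X (suc (k *ℕ l)) ⊆ X (k *ℕ l)
  stable (d , d≤K , stall) = subst (λ e → X (suc e) ⊆ X e) (ℕ.m∸n+n≡m d≤K) (from-stall (k *ℕ l ∸ d))
    where
    from-stall : ∀ e → X (suc (e +ℕ d)) ⊆ X (e +ℕ d)
    from-stall zero    = count-reflect (ascending d) stall
    from-stall (suc e) = propagates (e +ℕ d) (from-stall e)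

descending-stabilises : (X : ℕ → BoolMatrix k l) → (∀ d → X (suc d) ⊆ X d) →
                        (∀ d → X d ⊆ X (suc d) → X (suc d) ⊆ X (suc (suc d))) →
                        X (k *ℕ l) ⊆ X (suc (k *ℕ l))
descending-stabilises {k} {l} X descending propagates =
  stable (bounded⇒stalls-descending (count ∘ X) (k *ℕ l) (count≤ (X 0)))
  where
  stable : ∃[ d ] (d ≤ℕ k *ℕ l × count (X d) ≤ℕ count (X (suc d))) → X (k *ℕ l) ⊆ X (suc (k *ℕ l))
  stable (d , d≤K , stall) = subst (λ e → X e ⊆ X (suc e)) (ℕ.m∸n+n≡m d≤K) (from-stall (k *ℕ l ∸ d))
    where
    from-stall : ∀ e → X (e +ℕ d) ⊆ X (suc (e +ℕ d))
    from-stall zero    = count-reflect (descending d) stall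
    from-stall (suc e) = propagates (e +ℕ d) (from-stall e)

-- Value iteration

module ValueIteration {n m : ℕ} (M : MDP n (suc m)) (T : Subset n) where

  δ-nonneg : ∀ q a q′ → 0ℚ ≤ δ M q a q′
  δ-nonneg q a = proj₁ (δ-dist M q a)

  δ-sum : ∀ q a → sumFin (δ M q a) ≡ 1ℚ
  δ-sum q a = proj₂ (δ-dist M q a)

  indicator : Fin n → ℚ
  indicator q = if lookup T q then 1ℚ else 0ℚ

  mutual
    miss : ℕ → Fin n → ℚ
    miss zero    q = 1ℚ - indicator q
    miss (suc t) q = missVia t q (bestAction t q)

    missVia : ℕ → Fin n → Fin (suc m) → ℚ
    missVia t q a = sumFin (λ q′ → δ M q a q′ * miss t q′)

    bestAction : ℕ → Fin n → Fin (suc m)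
    bestAction t q = argminFin (missVia t q)

  miss-suc≤missVia : ∀ t q a → miss (suc t) q ≤ missVia t q a
  miss-suc≤missVia t q = argminFin-≤ (missVia t q)

  ≤missVia : ∀ {γ} t q a → (∀ q′ → 0ℚ < δ M q a q′ → γ ≤ miss t q′) → γ ≤ missVia t q a
  ≤missVia {γ} t q a γ≤miss =
    subst (_≤ missVia t q a) (average-const (δ M q a) (δ-sum q a) γ) (weighted-mono (δ-nonneg q a) γ≤miss)

  miss-nonneg : ∀ t q → 0ℚ ≤ miss t q
  miss-nonneg zero q with lookup T q
  ... | true  = ≤-reflexive (sym (+-inverseʳ 1ℚ))
  ... | false = nonNegative⁻¹ 1ℚ
  miss-nonneg (suc t) q = sumFin-nonneg (λ q′ → *-nonneg (δ-nonneg q _ q′) (miss-nonneg t q′))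

  miss≤1 : ∀ t q → miss t q ≤ 1ℚ
  miss≤1 zero q with lookup T q
  ... | true  = ≤-trans (≤-reflexive (+-inverseʳ 1ℚ)) (nonNegative⁻¹ 1ℚ)
  ... | false = ≤-reflexive (+-identityʳ 1ℚ)
  miss≤1 (suc t) q = begin
    missVia t q a                       ≤⟨ weighted-mono (δ-nonneg q a) (λ q′ _ → miss≤1 t q′) ⟩
    sumFin (λ q′ → δ M q a q′ * 1ℚ)      ≡⟨ average-const (δ M q a) (δ-sum q a) 1ℚ ⟩
    1ℚ                                  ∎
    where
    open ≤-Reasoning
    a : Fin (suc m)
    a = bestAction t q

  Past : Set
  Past = List (Fin n × Fin (suc m))

  probInT : Strategy n (suc m) → ℕ → Past → Fin n → ℚ
  probInT S t h q = sumFin (λ q′ → indicator q′ * reachFrom M S t h q q′)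

  probInT-zero : ∀ S h q → probInT S zero h q ≡ 1ℚ - miss zero q
  probInT-zero S h q = begin
    sumFin (λ q′ → indicator q′ * dirac q q′) ≡⟨ sumFin-cong (λ q′ → *-comm (indicator q′) (dirac q q′)) ⟩
    sumFin (λ q′ → dirac q q′ * indicator q′) ≡⟨ sumFin-dirac q indicator ⟩
    indicator q                               ≡⟨ solve 1 (λ x → x := con 1ℚ :- (con 1ℚ :- x)) refl (indicator q) ⟩
    1ℚ - miss zero q                          ∎
    where open ≡-Reasoning

  probInT-suc : ∀ S t h q → probInT S (suc t) h q ≡
    sumFin (λ a → σ S (h , q) a * sumFin (λ q′ → δ M q a q′ * probInT S t (h ++ [ (q , a) ]) q′))
  probInT-suc S t h q =
    trans (sumFin-interchange indicator (σ S (h , q)) reachAfter)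
          (sumFin-cong (λ a → cong (σ S (h , q) a *_)
            (sumFin-interchange indicator (δ M q a) (reachFrom M S t (h ++ [ (q , a) ])))))
    where
    reachAfter : Fin (suc m) → Fin n → ℚ
    reachAfter a q″ = sumFin (λ q′ → δ M q a q′ * reachFrom M S t (h ++ [ (q , a) ]) q′ q″)

  probInT≤1-miss : ∀ S t h q → probInT S t h q ≤ 1ℚ - miss t q
  probInT≤1-miss S zero    h q = ≤-reflexive (probInT-zero S h q)
  probInT≤1-miss S (suc t) h q = begin
    probInT S (suc t) h q
      ≡⟨ probInT-suc S t h q ⟩
    sumFin (λ a → σ S (h , q) a * sumFin (λ q′ → δ M q a q′ * probInT S t (h ++ [ (q , a) ]) q′))
      ≤⟨ weighted-mono σ-nonneg (λ a _ → weighted-mono (δ-nonneg q a) (λ q′ _ → probInT≤1-miss S t (h ++ [ (q , a) ]) q′)) ⟩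
    sumFin (λ a → σ S (h , q) a * sumFin (λ q′ → δ M q a q′ * (1ℚ - miss t q′)))
      ≡⟨ sumFin-cong (λ a → cong (σ S (h , q) a *_) (average-1- (δ M q a) (δ-sum q a) (miss t))) ⟩
    sumFin (λ a → σ S (h , q) a * (1ℚ - missVia t q a))
      ≤⟨ weighted-mono σ-nonneg (λ a _ → 1-‿antimono-≤ (miss-suc≤missVia t q a)) ⟩
    sumFin (λ a → σ S (h , q) a * (1ℚ - miss (suc t) q))
      ≡⟨ average-const (σ S (h , q)) (proj₂ (σ-dist S (h , q))) _ ⟩
    1ℚ - miss (suc t) q ∎
    where
    open ≤-Reasoning
    σ-nonneg : ∀ a → 0ℚ ≤ σ S (h , q) a
    σ-nonneg = proj₁ (σ-dist S (h , q))

  greedy : ℕ → Strategy n (suc m)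
  greedy j = record
    { σ      = λ (h , q) → dirac (bestAction (j ∸ suc (length h)) q)
    ; σ-dist = λ (h , q) → dirac-isDist (bestAction (j ∸ suc (length h)) q)
    }

  probInT-deterministic : ∀ S t h q b → (∀ a → σ S (h , q) a ≡ dirac b a) →
    probInT S (suc t) h q ≡ sumFin (λ q′ → δ M q b q′ * probInT S t (h ++ [ (q , b) ]) q′)
  probInT-deterministic S t h q b σ≡dirac = begin
    probInT S (suc t) h q
      ≡⟨ probInT-suc S t h q ⟩
    sumFin (λ a → σ S (h , q) a * next a)
      ≡⟨ sumFin-cong (λ a → cong (_* next a) (σ≡dirac a)) ⟩
    sumFin (λ a → dirac b a * next a)
      ≡⟨ sumFin-dirac b next ⟩
    next b ∎
    where
    open ≡-Reasoning
    next : Fin (suc m) → ℚ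
    next a = sumFin (λ q′ → δ M q a q′ * probInT S t (h ++ [ (q , a) ]) q′)

  probInT-greedy : ∀ j t h q → length h +ℕ t ≡ j → probInT (greedy j) t h q ≡ 1ℚ - miss t q
  probInT-greedy j zero    h q _  = probInT-zero (greedy j) h q
  probInT-greedy j (suc t) h q eq = begin
    probInT (greedy j) (suc t) h q
      ≡⟨ probInT-deterministic (greedy j) t h q b (λ _ → refl) ⟩
    sumFin (λ q′ → δ M q b q′ * probInT (greedy j) t (h ++ [ (q , b) ]) q′)
      ≡⟨ sumFin-cong (λ q′ → cong (δ M q b q′ *_) (probInT-greedy j t (h ++ [ (q , b) ]) q′ eq′)) ⟩
    sumFin (λ q′ → δ M q b q′ * (1ℚ - miss t q′))
      ≡⟨ average-1- (δ M q b) (δ-sum q b) (miss t) ⟩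
    1ℚ - missVia t q b
      ≡⟨ cong (λ s → 1ℚ - missVia t q (bestAction s q)) remaining ⟩
    1ℚ - miss (suc t) q ∎
    where
    open ≡-Reasoning
    b : Fin (suc m)
    b = bestAction (j ∸ suc (length h)) q
    remaining : j ∸ suc (length h) ≡ t
    remaining = begin
      j ∸ suc (length h)                   ≡⟨ cong (_∸ suc (length h)) eq ⟨
      length h +ℕ suc t ∸ suc (length h)   ≡⟨ cong (_∸ suc (length h)) (ℕ.+-suc (length h) t) ⟩
      suc (length h) +ℕ t ∸ suc (length h) ≡⟨ ℕ.m+n∸m≡n (suc (length h)) t ⟩
      t                                    ∎
    eq′ : length (h ++ [ (q , b) ]) +ℕ t ≡ j
    eq′ = begin
      length (h ++ [ (q , b) ]) +ℕ t ≡⟨ cong (_+ℕ t) (length-++ h) ⟩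
      length h +ℕ 1 +ℕ t             ≡⟨ ℕ.+-assoc (length h) 1 t ⟩
      length h +ℕ suc t              ≡⟨ eq ⟩
      j                              ∎

  expectedMiss : (Fin n → ℚ) → ℕ → ℚ
  expectedMiss d t = sumFin (λ q → d q * miss t q)

  mass-distAt : ∀ S d₀ i → mass (distAt M S d₀ i) T ≡ sumFin (λ q → d₀ q * probInT S i [] q)
  mass-distAt S d₀ i =
    trans (sumFin-cong restrict) (sumFin-interchange indicator d₀ (λ q₀ → reachFrom M S i [] q₀))
    where
    restrict : ∀ q → (if lookup T q then distAt M S d₀ i q else 0ℚ) ≡ indicator q * distAt M S d₀ i q
    restrict q with lookup T q
    ... | true  = sym (*-identityˡ (distAt M S d₀ i q))
    ... | false = sym (*-zeroˡ (distAt M S d₀ i q))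

  mass≤1-expectedMiss : ∀ {d₀} → IsDist d₀ → ∀ S i → mass (distAt M S d₀ i) T ≤ 1ℚ - expectedMiss d₀ i
  mass≤1-expectedMiss {d₀} (0≤d₀ , Σd₀≡1) S i = begin
    mass (distAt M S d₀ i) T                  ≡⟨ mass-distAt S d₀ i ⟩
    sumFin (λ q → d₀ q * probInT S i [] q)    ≤⟨ weighted-mono 0≤d₀ (λ q _ → probInT≤1-miss S i [] q) ⟩
    sumFin (λ q → d₀ q * (1ℚ - miss i q))     ≡⟨ average-1- d₀ Σd₀≡1 (miss i) ⟩
    1ℚ - expectedMiss d₀ i                    ∎
    where open ≤-Reasoning

  mass-greedy : ∀ {d₀} → IsDist d₀ → ∀ i → mass (distAt M (greedy i) d₀ i) T ≡ 1ℚ - expectedMiss d₀ i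
  mass-greedy {d₀} (_ , Σd₀≡1) i = begin
    mass (distAt M (greedy i) d₀ i) T             ≡⟨ mass-distAt (greedy i) d₀ i ⟩
    sumFin (λ q → d₀ q * probInT (greedy i) i [] q) ≡⟨ sumFin-cong (λ q → cong (d₀ q *_) (probInT-greedy i i [] q refl)) ⟩
    sumFin (λ q → d₀ q * (1ℚ - miss i q))         ≡⟨ average-1- d₀ Σd₀≡1 (miss i) ⟩
    1ℚ - expectedMiss d₀ i                        ∎
    where open ≡-Reasoning

  limitSure-if-vanishing : ∀ {d₀} → IsDist d₀ →
    (∀ ε → 0ℚ < ε → ∃[ t ] ∀ q → 0ℚ < d₀ q → miss t q ≤ ε) → LimitSureEventually M T d₀
  limitSure-if-vanishing {d₀} d₀-dist@(0≤d₀ , Σd₀≡1) vanishing ε 0<ε = from (vanishing ε 0<ε)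
    where
    from : (∃[ t ] ∀ q → 0ℚ < d₀ q → miss t q ≤ ε) → ∃[ S ] ∃[ i ] 1ℚ - ε ≤ mass (distAt M S d₀ i) T
    from (t , small) = greedy t , t , (begin
      1ℚ - ε                         ≤⟨ 1-‿antimono-≤ E≤ε ⟩
      1ℚ - expectedMiss d₀ t         ≡⟨ mass-greedy d₀-dist t ⟨
      mass (distAt M (greedy t) d₀ t) T ∎)
      where
      open ≤-Reasoning
      E≤ε : expectedMiss d₀ t ≤ ε
      E≤ε = ≤-trans (weighted-mono 0≤d₀ small) (≤-reflexive (average-const d₀ Σd₀≡1 ε))

  miss<-on-support : ∀ {d₀ α₀ x} → IsDist d₀ → 0ℚ < α₀ → (∀ q → 0ℚ < d₀ q → α₀ ≤ d₀ q) →
                     ∀ i → expectedMiss d₀ i < α₀ * x → ∀ q → 0ℚ < d₀ q → miss i q < x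
  miss<-on-support {d₀} {α₀} {x} (0≤d₀ , _) 0<α₀ α₀≤d₀ i E<α₀x q 0<d₀q =
    *-cancelˡ-<-nonNeg α₀ {{nonNegative (<⇒≤ 0<α₀)}} (begin-strict
      α₀ * miss i q         ≤⟨ *-monoʳ-≤-0≤ (miss-nonneg i q) (α₀≤d₀ q 0<d₀q) ⟩
      d₀ q * miss i q       ≤⟨ term≤sumFin (λ q′ → *-nonneg (0≤d₀ q′) (miss-nonneg i q′)) q ⟩
      expectedMiss d₀ i     <⟨ E<α₀x ⟩
      α₀ * x                ∎)
    where open ≤-Reasoning

  module Zeros {α : ℚ} (α-min : IsMinPosTransition M α) where

    0<α : 0ℚ < α
    0<α = proj₁ α-min

    0≤α : 0ℚ ≤ α
    0≤α = <⇒≤ 0<α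

    α≤δ : ∀ q a q′ → 0ℚ < δ M q a q′ → α ≤ δ M q a q′
    α≤δ = proj₂ (proj₂ α-min)

    α≤1 : α ≤ 1ℚ
    α≤1 with proj₁ (proj₂ α-min)
    ... | q , a , q′ , δ≡α =
      subst (_≤ 1ℚ) δ≡α (≤-trans (term≤sumFin (δ-nonneg q a) q′) (≤-reflexive (δ-sum q a)))

    α*miss≤missVia : ∀ t q a q′ → 0ℚ < δ M q a q′ → α * miss t q′ ≤ missVia t q a
    α*miss≤missVia t q a q′ 0<δ =
      ≤-trans (*-monoʳ-≤-0≤ (miss-nonneg t q′) (α≤δ q a q′ 0<δ))
              (term≤sumFin (λ q″ → *-nonneg (δ-nonneg q a q″) (miss-nonneg t q″)) q′)

    missVia≡0 : ∀ t q a → (∀ q′ → 0ℚ < δ M q a q′ → miss t q′ ≡ 0ℚ) → missVia t q a ≡ 0ℚ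
    missVia≡0 t q a succ≡0 = ≤-antisym
      (≤-trans (weighted-mono (δ-nonneg q a) (λ q′ 0<δ → ≤-reflexive (succ≡0 q′ 0<δ)))
               (≤-reflexive (average-const (δ M q a) (δ-sum q a) 0ℚ)))
      (sumFin-nonneg (λ q′ → *-nonneg (δ-nonneg q a q′) (miss-nonneg t q′)))

    miss≡0⊎α^≤miss : ∀ t q → miss t q ≡ 0ℚ ⊎ α ^ℚ t ≤ miss t q
    miss≡0⊎α^≤miss zero q with lookup T q
    ... | true  = inj₁ (+-inverseʳ 1ℚ)
    ... | false = inj₂ ≤-refl
    miss≡0⊎α^≤miss (suc t) q
      with any? (λ q′ → (0ℚ <? δ M q (bestAction t q) q′) ×-dec ¬? (miss t q′ ≟ 0ℚ))
    ... | yes (q′ , 0<δ , miss≢0) with miss≡0⊎α^≤miss t q′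
    ...   | inj₁ miss≡0 = contradiction miss≡0 miss≢0
    ...   | inj₂ α^≤miss =
      inj₂ (≤-trans (*-monoˡ-≤-0≤ 0≤α α^≤miss) (α*miss≤missVia t q (bestAction t q) q′ 0<δ))
    miss≡0⊎α^≤miss (suc t) q | no ∄ = inj₁ (missVia≡0 t q (bestAction t q) λ q′ 0<δ →
      decidable-stable (miss t q′ ≟ 0ℚ) (λ miss≢0 → ∄ (q′ , 0<δ , miss≢0)))

    miss<α^⇒miss≡0 : ∀ t q → miss t q < α ^ℚ t → miss t q ≡ 0ℚ
    miss<α^⇒miss≡0 t q miss<α^ with miss≡0⊎α^≤miss t q
    ... | inj₁ miss≡0  = miss≡0
    ... | inj₂ α^≤miss = contradiction (<-≤-trans miss<α^ α^≤miss) (<-irrefl refl)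

    miss-suc≡0⇔ : ∀ t q → miss (suc t) q ≡ 0ℚ ⇔ (∃[ a ] ∀ q′ → 0ℚ < δ M q a q′ → miss t q′ ≡ 0ℚ)
    miss-suc≡0⇔ t q = mk⇔
      (λ miss≡0 → bestAction t q , λ q′ 0<δ → ≤-antisym
         (*-cancelˡ-≤-pos α {{positive 0<α}}
           (≤-trans (α*miss≤missVia t q (bestAction t q) q′ 0<δ) (≤-reflexive (trans miss≡0 (sym (*-zeroʳ α))))))
         (miss-nonneg t q′))
      (λ (a , succ≡0) → ≤-antisym
         (≤-trans (miss-suc≤missVia t q a) (≤-reflexive (missVia≡0 t q a succ≡0)))
         (miss-nonneg (suc t) q))

    SameZeros : ℕ → ℕ → Set
    SameZeros s t = ∀ q → miss s q ≡ 0ℚ ⇔ miss t q ≡ 0ℚ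

    SameZeros-trans : ∀ {s t u} → SameZeros s t → SameZeros t u → SameZeros s u
    SameZeros-trans s~t t~u q = ⇔.trans (s~t q) (t~u q)

    zeros-along : ∀ {u v} q → (∀ q′ → miss u q′ ≡ 0ℚ → miss v q′ ≡ 0ℚ) →
                  (∃[ a ] ∀ q′ → 0ℚ < δ M q a q′ → miss u q′ ≡ 0ℚ) →
                  (∃[ a ] ∀ q′ → 0ℚ < δ M q a q′ → miss v q′ ≡ 0ℚ)
    zeros-along q u⇒v (a , succ≡0) = a , λ q′ 0<δ → u⇒v q′ (succ≡0 q′ 0<δ)

    SameZeros-suc : ∀ {s t} → SameZeros s t → SameZeros (suc s) (suc t)
    SameZeros-suc {s} {t} s~t q = ⇔.trans (miss-suc≡0⇔ s q) (⇔.trans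
      (mk⇔ (zeros-along {s} {t} q (Equivalence.to ∘ s~t)) (zeros-along {t} {s} q (Equivalence.from ∘ s~t)))
      (⇔.sym (miss-suc≡0⇔ t q)))

    SameZeros-+ˡ : ∀ {s t} w → SameZeros s t → SameZeros (w +ℕ s) (w +ℕ t)
    SameZeros-+ˡ         zero    s~t = s~t
    SameZeros-+ˡ {s} {t} (suc w) s~t = SameZeros-suc {w +ℕ s} {w +ℕ t} (SameZeros-+ˡ {s} {t} w s~t)

    zeroPattern : ℕ → Fin n → Fin 2
    zeroPattern t q = if isYes (miss t q ≟ 0ℚ) then zero else suc zero

    samePattern⇒SameZeros : ∀ {s t} → zeroPattern s ≗ zeroPattern t → SameZeros s t
    samePattern⇒SameZeros {s} {t} same q with miss s q ≟ 0ℚ | miss t q ≟ 0ℚ | same q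
    ... | yes s≡0 | yes t≡0 | _  = mk⇔ (λ _ → t≡0) (λ _ → s≡0)
    ... | no  s≢0 | no  t≢0 | _  = mk⇔ (λ s≡0 → contradiction s≡0 s≢0) (λ t≡0 → contradiction t≡0 t≢0)
    ... | yes _   | no  _   | ()
    ... | no  _   | yes _   | ()

    eventuallyPeriodic : ∃[ r ] ∃[ p′ ] (r +ℕ suc p′ ≤ℕ 2 ^ℕ n × SameZeros r (suc p′ +ℕ r))
    eventuallyPeriodic with pigeonhole (ℕ.n<1+n (2 ^ℕ n)) (λ i → funToFin (zeroPattern (toℕ i)))
    ... | i , j , i<j , codes≡ = toℕ i , toℕ j ∸ suc (toℕ i) , bounded , periodic
      where
      j≡ : suc (toℕ j ∸ suc (toℕ i)) +ℕ toℕ i ≡ toℕ j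
      j≡ = trans (sym (ℕ.+-suc _ (toℕ i))) (ℕ.m∸n+n≡m i<j)
      bounded : toℕ i +ℕ suc (toℕ j ∸ suc (toℕ i)) ≤ℕ 2 ^ℕ n
      bounded = ℕ.≤-trans (ℕ.≤-reflexive (trans (ℕ.+-comm (toℕ i) _) j≡)) (toℕ≤pred[n]′ j)
      periodic : SameZeros (toℕ i) (suc (toℕ j ∸ suc (toℕ i)) +ℕ toℕ i)
      periodic = subst (SameZeros (toℕ i)) (sym j≡) (samePattern⇒SameZeros {toℕ i} {toℕ j} λ q →
        trans (sym (finToFun-funToFin (zeroPattern (toℕ i)) q))
              (trans (cong (λ c → finToFun c q) codes≡) (finToFun-funToFin (zeroPattern (toℕ j)) q)))

    module PhaseGame (r p′ : ℕ) (periodic : SameZeros r (suc p′ +ℕ r)) where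

      p : ℕ
      p = suc p′

      SameZeros-shift : ∀ u → SameZeros (u +ℕ r) (p +ℕ u +ℕ r)
      SameZeros-shift u = subst (SameZeros (u +ℕ r)) u+[p+r]≡p+u+r (SameZeros-+ˡ {r} {p +ℕ r} u periodic)
        where
        u+[p+r]≡p+u+r : u +ℕ (p +ℕ r) ≡ p +ℕ u +ℕ r
        u+[p+r]≡p+u+r = trans (sym (ℕ.+-assoc u p r)) (cong (_+ℕ r) (ℕ.+-comm u p))

      SameZeros-mod : ∀ u → SameZeros (u % p +ℕ r) (u +ℕ r)
      SameZeros-mod u = subst (λ v → SameZeros (u % p +ℕ r) (v +ℕ r))
        (trans (ℕ.+-comm (u / p *ℕ p) (u % p)) (sym (m≡m%n+[m/n]*n u p))) (add-periods (u / p) (u % p))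
        where
        add-periods : ∀ k x → SameZeros (x +ℕ r) (k *ℕ p +ℕ x +ℕ r)
        add-periods zero    x = λ _ → ⇔.refl
        add-periods (suc k) x = subst (λ v → SameZeros (x +ℕ r) (v +ℕ r)) (sym (ℕ.+-assoc p (k *ℕ p) x))
          (SameZeros-trans {x +ℕ r} {k *ℕ p +ℕ x +ℕ r} {p +ℕ (k *ℕ p +ℕ x) +ℕ r}
            (add-periods k x) (SameZeros-shift (k *ℕ p +ℕ x)))

      -- A time u stands for the horizon u + r, which only matters modulo p; one step of play
      -- consumes one unit of horizon, so successors live at the previous phase.
      phase : ℕ → Fin p
      phase u = u mod p

      previous : Fin p → Fin p
      previous φ = (toℕ φ +ℕ p′) mod p

      toℕ-phase : ∀ u → toℕ (phase u) ≡ u % p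
      toℕ-phase u = toℕ-fromℕ< (m%n<n u p)

      previous-phase : ∀ u → previous (phase (suc u)) ≡ phase u
      previous-phase u = toℕ-injective (begin
        toℕ (previous (phase (suc u))) ≡⟨ toℕ-phase (toℕ (phase (suc u)) +ℕ p′) ⟩
        (toℕ (phase (suc u)) +ℕ p′) % p ≡⟨ cong (λ x → (x +ℕ p′) % p) (toℕ-phase (suc u)) ⟩
        (suc u % p +ℕ p′) % p          ≡⟨ %-distribˡ-+ (suc u % p) p′ p ⟩
        (suc u % p % p +ℕ p′ % p) % p  ≡⟨ cong (λ x → (x +ℕ p′ % p) % p) (m%n%n≡m%n (suc u) p) ⟩
        (suc u % p +ℕ p′ % p) % p      ≡⟨ %-distribˡ-+ (suc u) p′ p ⟨
        (suc u +ℕ p′) % p              ≡⟨ cong (_% p) (ℕ.+-suc u p′) ⟨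
        (u +ℕ p) % p                   ≡⟨ [m+n]%n≡m%n u p ⟩
        u % p                          ≡⟨ toℕ-phase u ⟨
        toℕ (phase u)                  ∎)
        where open ≡-Reasoning

      phase-periodic : ∀ u k → phase (u +ℕ k *ℕ p) ≡ phase u
      phase-periodic u k =
        toℕ-injective (trans (toℕ-phase (u +ℕ k *ℕ p)) (trans ([m+kn]%n≡m%n u k p) (sym (toℕ-phase u))))

      PhaseSet : Set
      PhaseSet = BoolMatrix p n

      Sure : PhaseSet
      Sure φ q = isYes (miss (toℕ φ +ℕ r) q ≟ 0ℚ)

      Sure⇔ : ∀ u q → IsTrue (Sure (phase u) q) ⇔ miss (u +ℕ r) q ≡ 0ℚ
      Sure⇔ u q = ⇔.trans (mk⇔ toWitness fromWitness)
        (subst (λ x → miss (x +ℕ r) q ≡ 0ℚ ⇔ miss (u +ℕ r) q ≡ 0ℚ) (sym (toℕ-phase u)) (SameZeros-mod u q))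

      Progress : PhaseSet → PhaseSet → Fin p → Fin n → Set
      Progress Y A ψ q = ∃[ a ] ((∀ q′ → 0ℚ < δ M q a q′ → IsTrue (Y ψ q′)) ×
                                 (∃[ q′ ] 0ℚ < δ M q a q′ × IsTrue (A ψ q′)))

      progress? : ∀ Y A ψ q → Dec (Progress Y A ψ q)
      progress? Y A ψ q = any? λ a →
        all? (λ q′ → (0ℚ <? δ M q a q′) →-dec T? (Y ψ q′)) ×-dec
        any? (λ q′ → (0ℚ <? δ M q a q′) ×-dec T? (A ψ q′))

      progress-mono : ∀ {Y Y′ A A′} → Y ⊆ Y′ → A ⊆ A′ → ∀ ψ q → Progress Y A ψ q → Progress Y′ A′ ψ q
      progress-mono Y⊆Y′ A⊆A′ ψ q (a , stays , q′ , 0<δ , ∈A) =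
        a , (λ q″ 0<δ″ → Y⊆Y′ ψ q″ (stays q″ 0<δ″)) , q′ , 0<δ , A⊆A′ ψ q′ ∈A

      extend : PhaseSet → PhaseSet → PhaseSet
      extend Y A φ q = A φ q ∨ (Y φ q ∧ isYes (progress? Y A (previous φ) q))

      extend⇔ : ∀ Y A φ q → IsTrue (extend Y A φ q) ⇔
                (IsTrue (A φ q) ⊎ (IsTrue (Y φ q) × Progress Y A (previous φ) q))
      extend⇔ Y A φ q = ⇔.trans T-∨ (mk⇔ (Sum.map₂ (Product.map₂ toWitness ∘ Equivalence.to T-∧′))
                                             (Sum.map₂ (Equivalence.from T-∧′ ∘ Product.map₂ fromWitness)))
        where
        T-∧′ : IsTrue (Y φ q ∧ isYes (progress? Y A (previous φ) q)) ⇔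
               (IsTrue (Y φ q) × IsTrue (isYes (progress? Y A (previous φ) q)))
        T-∧′ = T-∧

      extend-intro : ∀ {Y A} u q → IsTrue (Y (phase (suc u)) q) → Progress Y A (phase u) q →
                     IsTrue (extend Y A (phase (suc u)) q)
      extend-intro {Y} {A} u q ∈Y prog = Equivalence.from (extend⇔ Y A (phase (suc u)) q)
        (inj₂ (∈Y , subst (λ ψ → Progress Y A ψ q) (sym (previous-phase u)) prog))

      extend-elim : ∀ {Y A} u q → IsTrue (extend Y A (phase (suc u)) q) →
                    IsTrue (A (phase (suc u)) q) ⊎ Progress Y A (phase u) q
      extend-elim {Y} {A} u q ∈ext = Sum.map₂ (subst (λ ψ → Progress Y A ψ q) (previous-phase u) ∘ proj₂)
                                               (Equivalence.to (extend⇔ Y A (phase (suc u)) q) ∈ext)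

      extend-mono : ∀ {Y Y′ A A′} → Y ⊆ Y′ → A ⊆ A′ → extend Y A ⊆ extend Y′ A′
      extend-mono {Y} {Y′} {A} {A′} Y⊆Y′ A⊆A′ φ q ∈ext = Equivalence.from (extend⇔ Y′ A′ φ q)
        (Sum.map (A⊆A′ φ q) (Product.map (Y⊆Y′ φ q) (progress-mono Y⊆Y′ A⊆A′ (previous φ) q))
                 (Equivalence.to (extend⇔ Y A φ q) ∈ext))

      extend⊆ : ∀ {Y A} → A ⊆ Y → extend Y A ⊆ Y
      extend⊆ {Y} {A} A⊆Y φ q ∈ext = Sum.[ A⊆Y φ q , proj₁ ] (Equivalence.to (extend⇔ Y A φ q) ∈ext)

      attractor : PhaseSet → ℕ → PhaseSet
      attractor Y zero    = Sure
      attractor Y (suc d) = extend Y (attractor Y d)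

      card : ℕ
      card = p *ℕ n

      attractor∞ : PhaseSet → PhaseSet
      attractor∞ Y = attractor Y card

      attractor-inc : ∀ Y d → attractor Y d ⊆ attractor Y (suc d)
      attractor-inc Y d φ q ∈A = Equivalence.from (extend⇔ Y (attractor Y d) φ q) (inj₁ ∈A)

      Sure⊆attractor : ∀ Y d → Sure ⊆ attractor Y d
      Sure⊆attractor Y zero    = ⊆-refl
      Sure⊆attractor Y (suc d) φ q ∈Sure = attractor-inc Y d φ q (Sure⊆attractor Y d φ q ∈Sure)

      attractor-mono : ∀ {Y Y′} → Y ⊆ Y′ → ∀ d → attractor Y d ⊆ attractor Y′ d
      attractor-mono Y⊆Y′ zero    = ⊆-refl
      attractor-mono Y⊆Y′ (suc d) = extend-mono Y⊆Y′ (attractor-mono Y⊆Y′ d)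

      attractor⊆ : ∀ {Y} → Sure ⊆ Y → ∀ d → attractor Y d ⊆ Y
      attractor⊆ Sure⊆Y zero    = Sure⊆Y
      attractor⊆ Sure⊆Y (suc d) = extend⊆ (attractor⊆ Sure⊆Y d)

      attractor-stable : ∀ Y → attractor Y (suc card) ⊆ attractor∞ Y
      attractor-stable Y = ascending-stabilises (attractor Y) (attractor-inc Y) (λ d → extend-mono ⊆-refl)

      safe : ℕ → PhaseSet
      safe zero    _ _ = true
      safe (suc j)     = attractor∞ (safe j)

      Sure⊆safe : ∀ j → Sure ⊆ safe j
      Sure⊆safe zero    φ q _ = _
      Sure⊆safe (suc j)       = Sure⊆attractor (safe j) card

      safe-stable : safe card ⊆ attractor∞ (safe card)
      safe-stable = descending-stabilises safe (λ j → attractor⊆ (Sure⊆safe j) card)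
                                               (λ j safe⊆ → attractor-mono safe⊆ card)

      outside-attractor : ∀ {Y β} → 0ℚ ≤ β → α * β ≤ α ^ℚ r →
                          (∀ u q → ¬ IsTrue (Y (phase u) q) → β ≤ miss (u +ℕ r) q) →
                          ∀ u q → ¬ IsTrue (attractor∞ Y (phase u) q) → α * β ≤ miss (u +ℕ r) q
      outside-attractor {Y} {β} 0≤β αβ≤α^r outside-Y = below
        where
        αβ≤β : α * β ≤ β
        αβ≤β = subst (α * β ≤_) (*-identityˡ β) (*-monoʳ-≤-0≤ 0≤β α≤1)

        below : ∀ u q → ¬ IsTrue (attractor∞ Y (phase u) q) → α * β ≤ miss (u +ℕ r) q
        below zero q ∉A with miss≡0⊎α^≤miss r q
        ... | inj₁ miss≡0  = contradiction (Sure⊆attractor Y card (phase 0) q (Equivalence.from (Sure⇔ 0 q) miss≡0)) ∉A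
        ... | inj₂ α^≤miss = ≤-trans αβ≤α^r α^≤miss
        below (suc u) q ∉A with T? (Y (phase (suc u)) q)
        ... | no  ∉Y = ≤-trans αβ≤β (outside-Y (suc u) q ∉Y)
        ... | yes ∈Y = every-action (bestAction (u +ℕ r) q)
          where
          every-action : ∀ a → α * β ≤ missVia (u +ℕ r) q a
          every-action a with any? (λ q′ → (0ℚ <? δ M q a q′) ×-dec ¬? (T? (Y (phase u) q′)))
          ... | yes (q′ , 0<δ , ∉Y′) =
            ≤-trans (*-monoˡ-≤-0≤ 0≤α (outside-Y u q′ ∉Y′)) (α*miss≤missVia (u +ℕ r) q a q′ 0<δ)
          ... | no ∄∉Y with any? (λ q′ → (0ℚ <? δ M q a q′) ×-dec T? (attractor∞ Y (phase u) q′))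
          ...   | yes (q′ , 0<δ , ∈A′) = contradiction
                    (attractor-stable Y (phase (suc u)) q
                      (extend-intro {Y} {attractor∞ Y} u q ∈Y (a , stays , q′ , 0<δ , ∈A′))) ∉A
            where
            stays : ∀ q″ → 0ℚ < δ M q a q″ → IsTrue (Y (phase u) q″)
            stays q″ 0<δ″ = decidable-stable (T? (Y (phase u) q″)) (λ ∉Y″ → ∄∉Y (q″ , 0<δ″ , ∉Y″))
          ...   | no ∄∈A = ≤missVia (u +ℕ r) q a (λ q′ 0<δ → below u q′ (λ ∈A′ → ∄∈A (q′ , 0<δ , ∈A′)))

      outside-safe : ∀ j u q → ¬ IsTrue (safe j (phase u) q) → α ^ℚ (j +ℕ r) ≤ miss (u +ℕ r) q
      outside-safe zero    u q ∉safe = contradiction _ ∉safe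
      outside-safe (suc j) = outside-attractor (^ℚ-nonneg (j +ℕ r) 0≤α)
                               (^ℚ-antitone 0≤α α≤1 (ℕ.m≤n+m r (suc j))) (outside-safe j)

      attractor-shaves : ∀ {Y L B} → 0ℚ ≤ B →
        (∀ u q → L ≤ℕ u → IsTrue (Y (phase u) q) → miss (u +ℕ r) q ≤ B) →
        ∀ d u q → L +ℕ d ≤ℕ u → IsTrue (attractor Y d (phase u) q) → miss (u +ℕ r) q ≤ (1ℚ - α ^ℚ d) * B
      attractor-shaves {B = B} 0≤B inside-Y zero u q _ ∈Sure = begin
        miss (u +ℕ r) q      ≡⟨ Equivalence.to (Sure⇔ u q) ∈Sure ⟩
        0ℚ                   ≡⟨ solve 1 (λ B → con 0ℚ := (con 1ℚ :- con 1ℚ) :* B) refl B ⟩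
        (1ℚ - 1ℚ) * B        ∎
        where open ≤-Reasoning
      attractor-shaves {L = L} 0≤B inside-Y (suc d) zero q L+d<0 _
        with () ← ℕ.≤-trans (ℕ.m≤n+m (suc d) L) L+d<0
      attractor-shaves {Y} {L} {B} 0≤B inside-Y (suc d) (suc u) q L+d<u ∈ext
        with extend-elim {Y} {attractor Y d} u q ∈ext
      ... | inj₁ ∈A = ≤-trans
        (attractor-shaves {Y} 0≤B inside-Y d (suc u) q (ℕ.m≤n⇒m≤1+n (m+[1+n]≤1+o⇒m+n≤o L+d<u)) ∈A)
        (*-monoʳ-≤-0≤ 0≤B (1-‿antimono-≤ (^ℚ-suc≤ d 0≤α α≤1)))
      ... | inj₂ (a , stays , q* , 0<δ* , ∈A*) = begin
        miss (suc u +ℕ r) q                                  ≤⟨ miss-suc≤missVia (u +ℕ r) q a ⟩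
        missVia (u +ℕ r) q a                                 ≤⟨ weighted-mono (δ-nonneg q a) successor-bound ⟩
        sumFin (λ z → δ M q a z * (B - dirac q* z * y))      ≡⟨ sumFin-cong (λ z → distribute (δ M q a z) (dirac q* z)) ⟩
        sumFin (λ z → δ M q a z * B - dirac q* z * (δ M q a z * y))
                                                             ≡⟨ sumFin-- (λ z → δ M q a z * B) (λ z → dirac q* z * (δ M q a z * y)) ⟩
        sumFin (λ z → δ M q a z * B) - sumFin (λ z → dirac q* z * (δ M q a z * y))
                                                             ≡⟨ cong₂ _-_ (average-const (δ M q a) (δ-sum q a) B)
                                                                          (sumFin-dirac q* (λ z → δ M q a z * y)) ⟩
        B - δ M q a q* * y                                   ≤⟨ +-monoʳ-≤ B (neg-antimono-≤ (*-monoʳ-≤-0≤ 0≤y (α≤δ q a q* 0<δ*))) ⟩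
        B - α * y                                            ≡⟨ solve 3 (λ B α α^d → B :- α :* (α^d :* B) := (con 1ℚ :- α :* α^d) :* B) refl B α (α ^ℚ d) ⟩
        (1ℚ - α ^ℚ suc d) * B                                ∎
        where
        open ≤-Reasoning
        y : ℚ
        y = α ^ℚ d * B
        0≤y : 0ℚ ≤ y
        0≤y = *-nonneg (^ℚ-nonneg d 0≤α) 0≤B
        L+d≤u : L +ℕ d ≤ℕ u
        L+d≤u = m+[1+n]≤1+o⇒m+n≤o L+d<u
        distribute : ∀ w e → w * (B - e * y) ≡ w * B - e * (w * y)
        distribute w e = solve 4 (λ w e B y → w :* (B :- e :* y) := w :* B :- e :* (w :* y)) refl w e B y
        successor-bound : ∀ z → 0ℚ < δ M q a z → miss (u +ℕ r) z ≤ B - dirac q* z * y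
        successor-bound z 0<δ with q* ≟ᶠ z
        ... | yes refl = ≤-trans (attractor-shaves {Y} 0≤B inside-Y d u q* L+d≤u ∈A*)
                                 (≤-reflexive (solve 2 (λ B α^d → (con 1ℚ :- α^d) :* B := B :- con 1ℚ :* (α^d :* B)) refl B (α ^ℚ d)))
        ... | no  _    = ≤-trans (inside-Y u z (ℕ.≤-trans (ℕ.m≤m+n L d) L+d≤u) (stays z 0<δ))
                                 (≤-reflexive (solve 2 (λ B y → B := B :- con 0ℚ :* y) refl B y))

      decay : ∀ {Y} → Y ⊆ attractor∞ Y →
              ∀ k u q → k *ℕ card ≤ℕ u → IsTrue (Y (phase u) q) → miss (u +ℕ r) q ≤ (1ℚ - α ^ℚ card) ^ℚ k
      decay closed zero    u q _  _  = miss≤1 (u +ℕ r) q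
      decay {Y} closed (suc k) u q le ∈Y =
        attractor-shaves {Y} (^ℚ-nonneg k (p≤1⇒0≤1-p (^ℚ≤1 card 0≤α α≤1))) (decay closed k) card u q
          (ℕ.≤-trans (ℕ.≤-reflexive (ℕ.+-comm (k *ℕ card) card)) le) (closed (phase u) q ∈Y)

      misses-vanish : ∀ {D : Fin n → Set} u₀ → (∀ q → D q → miss (u₀ +ℕ r) q < α ^ℚ (card +ℕ r)) →
                      ∀ ε → 0ℚ < ε → ∃[ t ] ∀ q → D q → miss t q ≤ ε
      misses-vanish {D} u₀ small ε 0<ε =
        after (geometric-decay (^ℚ-pos card 0<α) (^ℚ≤1 card 0≤α α≤1) 0<ε)
        where
        ∈safe : ∀ q → D q → IsTrue (safe card (phase u₀) q)
        ∈safe q Dq = decidable-stable (T? (safe card (phase u₀) q))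
          (λ ∉safe → <-irrefl refl (<-≤-trans (small q Dq) (outside-safe card u₀ q ∉safe)))
        after : ∃[ k ] (1ℚ - α ^ℚ card) ^ℚ k ≤ ε → ∃[ t ] ∀ q → D q → miss t q ≤ ε
        after (k , c^k≤ε) = u₀ +ℕ k *ℕ card *ℕ p +ℕ r , λ q Dq →
          ≤-trans (decay {safe card} safe-stable k (u₀ +ℕ k *ℕ card *ℕ p) q
                     (ℕ.≤-trans (ℕ.m≤m*n (k *ℕ card) p) (ℕ.m≤n+m (k *ℕ card *ℕ p) u₀))
                     (subst (λ φ → IsTrue (safe card φ q)) (sym (phase-periodic u₀ (k *ℕ card))) (∈safe q Dq)))
                  c^k≤ε

    limitSure-if-small : ∀ {d₀} → IsDist d₀ → ∀ i →
      (∀ q → 0ℚ < d₀ q → miss i q < α ^ℚ (suc n *ℕ 2 ^ℕ n)) → LimitSureEventually M T d₀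
    limitSure-if-small {d₀} d₀-dist i small = from-period eventuallyPeriodic
      where
      2ⁿ≤N : 2 ^ℕ n ≤ℕ suc n *ℕ 2 ^ℕ n
      2ⁿ≤N = ℕ.m≤m+n (2 ^ℕ n) (n *ℕ 2 ^ℕ n)

      from-period : ∃[ r ] ∃[ p′ ] (r +ℕ suc p′ ≤ℕ 2 ^ℕ n × SameZeros r (suc p′ +ℕ r)) →
                    LimitSureEventually M T d₀
      from-period (r , p′ , r+p≤2ⁿ , periodic) with r ℕ.≤? i
      ... | no r≰i = limitSure-if-vanishing d₀-dist λ ε 0<ε → i , λ q 0<d₀q →
        ≤-trans (≤-reflexive (miss<α^⇒miss≡0 i q (<-≤-trans (small q 0<d₀q) (^ℚ-antitone 0≤α α≤1 i≤N))))
                (<⇒≤ 0<ε)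
        where
        i≤N : i ≤ℕ suc n *ℕ 2 ^ℕ n
        i≤N = ℕ.≤-trans (ℕ.<⇒≤ (ℕ.≰⇒> r≰i)) (ℕ.≤-trans (ℕ.≤-trans (ℕ.m≤m+n r (suc p′)) r+p≤2ⁿ) 2ⁿ≤N)
      ... | yes r≤i = limitSure-if-vanishing d₀-dist (misses-vanish (i ∸ r) small-at-phase)
        where
        open PhaseGame r p′ periodic
        card+r≤N : card +ℕ r ≤ℕ suc n *ℕ 2 ^ℕ n
        card+r≤N = ℕ.≤-trans (ℕ.+-mono-≤ card≤n2ⁿ (ℕ.≤-trans (ℕ.m≤m+n r p) r+p≤2ⁿ))
                             (ℕ.≤-reflexive (ℕ.+-comm (n *ℕ 2 ^ℕ n) (2 ^ℕ n)))
          where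
          card≤n2ⁿ : card ≤ℕ n *ℕ 2 ^ℕ n
          card≤n2ⁿ = ℕ.≤-trans (ℕ.*-monoˡ-≤ n (ℕ.≤-trans (ℕ.m≤n+m p r) r+p≤2ⁿ))
                               (ℕ.≤-reflexive (ℕ.*-comm (2 ^ℕ n) n))
        small-at-phase : ∀ q → 0ℚ < d₀ q → miss (i ∸ r +ℕ r) q < α ^ℚ (card +ℕ r)
        small-at-phase q 0<d₀q = subst (λ t → miss t q < α ^ℚ (card +ℕ r)) (sym (ℕ.m∸n+n≡m r≤i))
          (<-≤-trans (small q 0<d₀q) (^ℚ-antitone 0≤α α≤1 card+r≤N))

theorem1 : {n m : ℕ} (M : MDP n m) (α : ℚ) (T : Subset n) (d₀ : Fin n → ℚ) (α₀ : ℚ) →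
           IsMinPosTransition M α → IsDist d₀ → IsMinPosProb d₀ α₀ →
           ¬ LimitSureEventually M T d₀ →
           ∀ (S : Strategy n m) (i : ℕ) →
             mass (distAt M S d₀ i) T ≤ 1ℚ - α₀ * (α ^ℚ (suc n *ℕ (2 ^ℕ n)))
-- Without actions there is no strategy: σ S h would sum to 0.
theorem1 {m = zero} M α T d₀ α₀ _ _ (_ , (q₀ , _) , _) _ S i =
  contradiction (proj₂ (σ-dist S ([] , q₀))) λ ()
theorem1 {n} {suc m} M α T d₀ α₀ α-min d₀-dist (0<α₀ , _ , α₀≤d₀) not-limit-sure S i =
  ≮⇒≥ λ bound<mass → not-limit-sure (limitSure-if-small d₀-dist i (support-misses-little bound<mass))
  where
  open ValueIteration M T
  open Zeros α-min
  support-misses-little : 1ℚ - α₀ * α ^ℚ (suc n *ℕ 2 ^ℕ n) < mass (distAt M S d₀ i) T →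
                          ∀ q → 0ℚ < d₀ q → miss i q < α ^ℚ (suc n *ℕ 2 ^ℕ n)
  support-misses-little bound<mass = miss<-on-support d₀-dist 0<α₀ α₀≤d₀ i
    (1-‿cancel-< (<-≤-trans bound<mass (mass≤1-expectedMiss d₀-dist S i)))
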